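{- Let $G^w=\langle\mathcal V,\mathcal X,\mathcal Y,\rho^e,\rho^s,\varphi,w^s\rangle$ be a weighted game structure and $c\in\mathbb N$. For all $f\in EF(c)$, $\sim ECpre_{sys}(f)=\overline{ECpre}_{env}(\sim f)$, where $\overline{ECpre}_{env}$ is the operator defined explicitly in the context.
   Context: $\mathcal V$ finite set of Boolean variables, $\mathcal X\subseteq\mathcal V$ inputs, $\mathcal Y=\mathcal V\setminus\mathcal X$ outputs, states $s\in2^{\mathcal V}$, $p(\cdot)$ maps assignments to primed copies over $\mathcal V'$; $\rho^e$ a propositional formula over $\mathcal V\cup\mathcal X'$, $\rho^s$ over $\mathcal V\cup\mathcal V'$; $w^s:2^{\mathcal V\cup\mathcal V'}\to\mathbb Z$ a partial weight function defined on $\rho^s$-transitions. $E(c)=\{0,\ldots,c\}\cup\{+\infty\}$, $EF(c)$ = functions $2^{\mathcal V}\to E(c)$; $\min,\max$ in the usual order with $+\infty$ largest. Negation $\sim$: $\sim0=+\infty$, $\sim(+\infty)=0$, $\sim x=c+1-x$ otherwise, pointwise on $EF(c)$. $EC_c((s,s'),e)$: $0$ if $(s,s')\not\models\rho^e$; else $+\infty$ if $e=+\infty$ or $(s,s')\models\neg\rho^s$; else $+\infty$ if $e-w^s(s,s')>c$; else $\max(0,e-w^s(s,s'))$. $ECpre_{sys}(f)(s)=\max_{s_{\mathcal X}\in2^{\mathcal X}}\min_{s_{\mathcal Y}\in2^{\mathcal Y}}EC_c((s,p(s_{\mathcal X},s_{\mathcal Y})),f(s_{\mathcal X},s_{\mathcal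 Y}))$. $\overline{EC}_c((s,s'),e)$ is given by the first applicable case: $+\infty$ if $(s,s')\not\models\rho^e$; $0$ if $e=0$ or $(s,s')\models\neg\rho^s$; $0$ if $e=+\infty$ and $w^s(s,s')+c<0$; $+\infty$ if $e=+\infty$ and $w^s(s,s')\ge0$; $c+1+w^s(s,s')$ if $e=+\infty$; $0$ if $e+w^s(s,s')\le0$; $+\infty$ if $e+w^s(s,s')>c$; $e+w^s(s,s')$ otherwise. $\overline{ECpre}_{env}(f)(s)=\min_{s_{\mathcal X}\in2^{\mathcal X}}\max_{s_{\mathcal Y}\in2^{\mathcal Y}}\overline{EC}_c((s,p(s_{\mathcal X},s_{\mathcal Y})),f(s_{\mathcal X},s_{\mathcal Y}))$. -}

module Defs where

open import Data.Bool using (Bool; true; false; if_then_else_)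
open import Data.Nat as ℕ using (ℕ; zero; suc; _≤ᵇ_; s≤s)
open import Data.Integer as ℤ using (ℤ; +_; -[1+_]; _+_; _-_)
open import Data.Fin using (Fin; toℕ; fromℕ<; opposite)
open import Data.Vec using (Vec; []; _∷_)
open import Data.List using (List; []; _∷_; map; concatMap; foldr)
open import Data.Product using (_×_; _,_; proj₁)
open import Relation.Nullary using (yes; no)

-- The variable set V is split into inputs X (nx variables) and outputs
-- Y (ny variables); a state s ∈ 2^V is a pair of assignments.
-- ρ^e is a propositional formula over V ∪ X', represented by its truth
-- table (a Boolean function of s and the primed inputs); ρ^s over
-- V ∪ V' likewise.  w^s is only consulted on ρ^s-transitions, so it is
-- represented as a total function whose values off ρ^s are irrelevant.
-- The winning condition φ plays no role in the statement.

record WGS : Set where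
  field
    nx ny : ℕ
    ρe    : Vec Bool nx × Vec Bool ny → Vec Bool nx → Bool
    ρs    : Vec Bool nx × Vec Bool ny → Vec Bool nx × Vec Bool ny → Bool
    ws    : Vec Bool nx × Vec Bool ny → Vec Bool nx × Vec Bool ny → ℤ

  State : Set
  State = Vec Bool nx × Vec Bool ny

data E (c : ℕ) : Set where
  fin : Fin (suc c) → E c
  ∞   : E c

EF : (G : WGS) → ℕ → Set
EF G c = WGS.State G → E c

module _ {c : ℕ} where

  zeroE : E c
  zeroE = fin Data.Fin.zero

  maxE : E c → E c → E c
  maxE ∞ _ = ∞
  maxE _ ∞ = ∞
  maxE (fin a) (fin b) = if toℕ a ≤ᵇ toℕ b then fin b else fin a

  minE : E c → E c → E c
  minE ∞ y = y
  minE x ∞ = x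
  minE (fin a) (fin b) = if toℕ a ≤ᵇ toℕ b then fin a else fin b

  ∼_ : E c → E c
  ∼ ∞ = zeroE
  ∼ fin Data.Fin.zero = ∞
  ∼ fin (Data.Fin.suc k) = fin (Data.Fin.suc (opposite k))   -- value c - k = c+1-(k+1)

  clamp : ℤ → E c
  clamp (+ n) with n ℕ.≤? c
  ... | yes p = fin (fromℕ< (s≤s p))
  ... | no _  = ∞
  clamp -[1+ n ] = zeroE

  toℤ : Fin (suc c) → ℤ
  toℤ k = + toℕ k

∼F : {G : WGS} {c : ℕ} → EF G c → EF G c
∼F f s = ∼ (f s)

allVecs : (n : ℕ) → List (Vec Bool n)
allVecs zero = [] ∷ []
allVecs (suc n) = concatMap (λ v → (false ∷ v) ∷ (true ∷ v) ∷ []) (allVecs n)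

maxL : {c : ℕ} → List (E c) → E c
maxL = foldr maxE zeroE

minL : {c : ℕ} → List (E c) → E c
minL = foldr minE ∞

module _ (G : WGS) (c : ℕ) where
  open WGS G

  EC : State → State → E c → E c
  EC s s' e with ρe s (proj₁ s')
  ... | false = zeroE
  ... | true with e | ρs s s'
  ...   | ∞     | _     = ∞
  ...   | fin _ | false = ∞
  ...   | fin k | true with (toℤ k - ws s s') ℤ.≤? + c
  ...     | no _  = ∞
  ...     | yes _ = clamp (toℤ k - ws s s')   -- = max(0, e - w)

  ECpreSys : EF G c → EF G c
  ECpreSys f s =
    maxL (map (λ sx → minL (map (λ sy → EC s (sx , sy) (f (sx , sy))) (allVecs ny)))
              (allVecs nx))

  ECbar : State → State → E c → E c
  ECbar s s' e with ρe s (proj₁ s')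
  ... | false = ∞
  ... | true with e | ρs s s'
  ...   | fin Data.Fin.zero | _ = zeroE
  ...   | _ | false = zeroE
  ...   | ∞ | true with ws s s' + + c ℤ.<? + 0
  ...     | yes _ = zeroE
  ...     | no _ with + 0 ℤ.≤? ws s s'
  ...       | yes _ = ∞
  ...       | no _  = clamp (+ suc c + ws s s')
  ECbar s s' e | true | fin k | true with toℤ k + ws s s' ℤ.≤? + 0
  ... | yes _ = zeroE
  ... | no _ with + c ℤ.<? toℤ k + ws s s'
  ...   | yes _ = ∞
  ...   | no _  = clamp (toℤ k + ws s s')

  ECpreEnvBar : EF G c → EF G c
  ECpreEnvBar f s =
    minL (map (λ sx → maxL (map (λ sy → ECbar s (sx , sy) (f (sx , sy))) (allVecs ny)))
              (allVecs nx))

-- The negation ∼ is antitone on E(c), so it exchanges max and min and turns the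
-- max–min of ECpre_sys into the min–max of the dual operator.  Pointwise, once
-- ρ^e and ρ^s hold, EC is clamp (e − w) and its dual is clamp (e + w), where clamp
-- sends d ≤ 0 to 0 and d > c to +∞; the identity ∼ clamp d = clamp (c + 1 − d)
-- then matches the two, because the dual reads its argument ∼ e as c + 1 − e
-- (in particular ∼ 0 = +∞ as c + 1).
module Submission where

open import Defs
open import Data.Nat using (ℕ)
open import Relation.Binary.PropositionalEquality using (_≡_)

open import Data.Bool using (Bool; true; false; T)
open import Data.Empty using (⊥-elim)
open import Data.Fin as Fin using (Fin; toℕ; fromℕ<; opposite)
import Data.Fin.Properties as Finₚ
open import Data.Integer as ℤ using (ℤ; +_; -[1+_]; _+_; _-_; _⊖_; +≤+; -≤+; +<+)
open import Data.Integer.Tactic.RingSolver using (solve-∀)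
import Data.Integer.Properties as ℤₚ
open import Data.List using ([]; _∷_; map)
open import Data.List.Properties using (map-cong)
import Data.Nat as ℕ
import Data.Nat.Properties as ℕₚ
open import Data.Product using (_×_; _,_; proj₁; proj₂)
open import Data.Sum using (_⊎_; inj₁; inj₂)
open import Relation.Binary.PropositionalEquality
  using (refl; sym; trans; cong; subst; subst₂; module ≡-Reasoning)
open import Relation.Nullary using (yes; no; contradiction)

module _ {c : ℕ} where

  infix 4 _≤E_

  data _≤E_ : E c → E c → Set where
    x≤∞     : ∀ {x} → x ≤E ∞
    fin≤fin : ∀ {a b} → toℕ a ℕ.≤ toℕ b → fin a ≤E fin b

  ≤E-total : ∀ x y → x ≤E y ⊎ y ≤E x
  ≤E-total x       ∞       = inj₁ x≤∞
  ≤E-total ∞       (fin b) = inj₂ x≤∞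
  ≤E-total (fin a) (fin b) with ℕₚ.≤-total (toℕ a) (toℕ b)
  ... | inj₁ a≤b = inj₁ (fin≤fin a≤b)
  ... | inj₂ b≤a = inj₂ (fin≤fin b≤a)

  zeroE-least : ∀ x → zeroE ≤E x
  zeroE-least ∞       = x≤∞
  zeroE-least (fin a) = fin≤fin ℕ.z≤n

  maxE-minE-≤ : ∀ {x y} → x ≤E y → maxE x y ≡ y × minE x y ≡ x
  maxE-minE-≤ {∞}     x≤∞ = refl , refl
  maxE-minE-≤ {fin a} x≤∞ = refl , refl
  maxE-minE-≤ (fin≤fin {a} {b} a≤b) with toℕ a ℕ.≤ᵇ toℕ b in a≤ᵇb
  ... | true  = refl , refl
  ... | false = ⊥-elim (subst T a≤ᵇb (ℕₚ.≤⇒≤ᵇ a≤b))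

  maxE-minE-≥ : ∀ {x y} → y ≤E x → maxE x y ≡ x × minE x y ≡ y
  maxE-minE-≥ {∞}     x≤∞ = refl , refl
  maxE-minE-≥ (fin≤fin {b} {a} b≤a) with toℕ a ℕ.≤ᵇ toℕ b in a≤ᵇb
  ... | true  = cong fin (sym a≡b) , cong fin a≡b
    where
    a≡b : a ≡ b
    a≡b = Finₚ.toℕ-injective
            (ℕₚ.≤-antisym (ℕₚ.≤ᵇ⇒≤ (toℕ a) (toℕ b) (subst T (sym a≤ᵇb) _)) b≤a)
  ... | false = refl , refl

  ∼-antitone : ∀ {x y} → x ≤E y → ∼ y ≤E ∼ x
  ∼-antitone {x}                 x≤∞ = zeroE-least (∼ x)
  ∼-antitone {fin Fin.zero}      _   = x≤∞
  ∼-antitone {fin (Fin.suc i)} {fin (Fin.suc j)} (fin≤fin (ℕ.s≤s i≤j)) =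
    fin≤fin (ℕ.s≤s (subst₂ ℕ._≤_ (sym (Finₚ.opposite-prop j)) (sym (Finₚ.opposite-prop i))
                              (ℕₚ.∸-monoʳ-≤ c (ℕ.s≤s i≤j))))

  ∼-maxE : ∀ x y → ∼ maxE x y ≡ minE (∼ x) (∼ y)
  ∼-maxE x y with ≤E-total x y
  ... | inj₁ x≤y = trans (cong ∼_ (proj₁ (maxE-minE-≤ x≤y)))
                         (sym (proj₂ (maxE-minE-≥ (∼-antitone x≤y))))
  ... | inj₂ y≤x = trans (cong ∼_ (proj₁ (maxE-minE-≥ y≤x)))
                         (sym (proj₂ (maxE-minE-≤ (∼-antitone y≤x))))

  ∼-minE : ∀ x y → ∼ minE x y ≡ maxE (∼ x) (∼ y)
  ∼-minE x y with ≤E-total x y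
  ... | inj₁ x≤y = trans (cong ∼_ (proj₂ (maxE-minE-≤ x≤y)))
                         (sym (proj₁ (maxE-minE-≥ (∼-antitone x≤y))))
  ... | inj₂ y≤x = trans (cong ∼_ (proj₂ (maxE-minE-≥ y≤x)))
                         (sym (proj₁ (maxE-minE-≤ (∼-antitone y≤x))))

  ∼-maxL-map : ∀ {A : Set} (g : A → E c) xs → ∼ maxL (map g xs) ≡ minL (map (λ a → ∼ g a) xs)
  ∼-maxL-map g []       = refl
  ∼-maxL-map g (a ∷ xs) = trans (∼-maxE (g a) _) (cong (minE (∼ g a)) (∼-maxL-map g xs))

  ∼-minL-map : ∀ {A : Set} (g : A → E c) xs → ∼ minL (map g xs) ≡ maxL (map (λ a → ∼ g a) xs)
  ∼-minL-map g []       = refl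
  ∼-minL-map g (a ∷ xs) = trans (∼-minE (g a) _) (cong (maxE (∼ g a)) (∼-minL-map g xs))

module _ {c : ℕ} where

  clamp-nonpos : ∀ {d} → d ℤ.≤ + 0 → clamp {c} d ≡ zeroE
  clamp-nonpos { -[1+ _ ]} _ = refl
  clamp-nonpos {+ 0} _ with 0 ℕ.≤? c
  ... | yes _   = refl
  ... | no 0≰c  = contradiction ℕ.z≤n 0≰c
  clamp-nonpos {+ ℕ.suc _} (+≤+ ())

  clamp-above : ∀ {d} → + c ℤ.< d → clamp {c} d ≡ ∞
  clamp-above {+ n} (+<+ c<n) with n ℕ.≤? c
  ... | yes n≤c = contradiction n≤c (ℕₚ.<⇒≱ c<n)
  ... | no _    = refl

  clamp-toℤ : ∀ k → clamp (toℤ {c} k) ≡ fin k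
  clamp-toℤ k with toℕ k ℕ.≤? c
  ... | yes k≤c = cong fin (Finₚ.fromℕ<-toℕ k (ℕ.s≤s k≤c))
  ... | no k≰c  = contradiction (Finₚ.toℕ≤pred[n] k) k≰c

  data ClampCase (d : ℤ) : Set where
    nonpos : d ℤ.≤ + 0 → ClampCase d
    above  : + c ℤ.< d → ClampCase d
    within : (i : Fin c) → d ≡ toℤ (Fin.suc i) → ClampCase d

  clampCase : ∀ d → ClampCase d
  clampCase -[1+ _ ]  = nonpos -≤+
  clampCase (+ 0)     = nonpos ℤₚ.≤-refl
  clampCase (+ ℕ.suc n) with n ℕ.<? c
  ... | yes n<c = within (fromℕ< n<c) (cong (λ m → + ℕ.suc m) (sym (Finₚ.toℕ-fromℕ< n<c)))
  ... | no n≮c  = above (+<+ (ℕ.s≤s (ℕₚ.≮⇒≥ n≮c)))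

  private
    c<1+c-d : ∀ {d} → d ℤ.≤ + 0 → + c ℤ.< + ℕ.suc c - d
    c<1+c-d { -[1+ n ]} _ = +<+ (ℕₚ.m≤m+n (ℕ.suc c) (ℕ.suc n))
    c<1+c-d {+ 0}       _ = +<+ (ℕₚ.m≤m+n (ℕ.suc c) 0)
    c<1+c-d {+ ℕ.suc _} (+≤+ ())

    1+c-d≤0 : ∀ {d} → + c ℤ.< d → + ℕ.suc c - d ℤ.≤ + 0
    1+c-d≤0 c<d = ℤₚ.i≤j⇒i-j≤0 (ℤₚ.i<j⇒suc[i]≤j c<d)

  toℤ-suc-opposite : ∀ (i : Fin c) → toℤ {c} (Fin.suc (opposite i)) ≡ + ℕ.suc c - toℤ {c} (Fin.suc i)
  toℤ-suc-opposite i = begin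
    + ℕ.suc (toℕ (opposite i))     ≡⟨ cong (λ m → + ℕ.suc m) (Finₚ.opposite-prop i) ⟩
    + ℕ.suc (c ℕ.∸ ℕ.suc (toℕ i))  ≡⟨ cong +_ (sym (ℕₚ.+-∸-assoc 1 (Finₚ.toℕ<n i))) ⟩
    + (c ℕ.∸ toℕ i)                ≡⟨ sym (ℤₚ.⊖-≥ (ℕₚ.<⇒≤ (Finₚ.toℕ<n i))) ⟩
    c ⊖ toℕ i                      ≡⟨ sym (ℤₚ.[1+m]⊖[1+n]≡m⊖n c (toℕ i)) ⟩
    ℕ.suc c ⊖ ℕ.suc (toℕ i)        ∎
    where open ≡-Reasoning

  ∼-clamp : ∀ d → ∼ clamp {c} d ≡ clamp (+ ℕ.suc c - d)
  ∼-clamp d with clampCase d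
  ... | nonpos d≤0 = trans (cong ∼_ (clamp-nonpos d≤0)) (sym (clamp-above (c<1+c-d d≤0)))
  ... | above c<d  = trans (cong ∼_ (clamp-above c<d)) (sym (clamp-nonpos (1+c-d≤0 c<d)))
  ... | within i refl = begin
    ∼ clamp (toℤ (Fin.suc i))              ≡⟨ cong ∼_ (clamp-toℤ (Fin.suc i)) ⟩
    fin (Fin.suc (opposite i))             ≡⟨ sym (clamp-toℤ (Fin.suc (opposite i))) ⟩
    clamp (toℤ (Fin.suc (opposite i)))     ≡⟨ cong clamp (toℤ-suc-opposite i) ⟩
    clamp (+ ℕ.suc c - toℤ (Fin.suc i))    ∎
    where open ≡-Reasoning

module _ {c : ℕ} where

  -- EC and its dual depend on a transition only through ρ^e, ρ^s and w^s, and every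
  -- comparison of e ∓ w with 0 and c made in their definitions is absorbed by clamp.
  ECvalue : Bool → Bool → ℤ → E c → E c
  ECvalue false _     _ _       = zeroE
  ECvalue true  _     _ ∞       = ∞
  ECvalue true  false _ (fin _) = ∞
  ECvalue true  true  w (fin k) = clamp (toℤ k - w)

  ECbarValue : Bool → Bool → ℤ → E c → E c
  ECbarValue false _     _ _                 = ∞
  ECbarValue true  _     _ (fin Fin.zero)    = zeroE
  ECbarValue true  false _ _                 = zeroE
  ECbarValue true  true  w ∞                 = clamp (+ ℕ.suc c + w)
  ECbarValue true  true  w (fin (Fin.suc j)) = clamp (toℤ (Fin.suc j) + w)

  private
    sub-sub : ∀ a b w → a - (b - w) ≡ (a - b) + w
    sub-sub = solve-∀

  ∼-ECvalue : ∀ b₁ b₂ w e → ∼ ECvalue b₁ b₂ w e ≡ ECbarValue b₁ b₂ w (∼ e)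
  ∼-ECvalue false _     _ _                 = refl
  ∼-ECvalue true  false _ ∞                 = refl
  ∼-ECvalue true  true  _ ∞                 = refl
  ∼-ECvalue true  false _ (fin Fin.zero)    = refl
  ∼-ECvalue true  false _ (fin (Fin.suc _)) = refl
  ∼-ECvalue true  true  w (fin Fin.zero)    =
    trans (∼-clamp (+ 0 - w))
          (cong clamp (trans (sub-sub (+ ℕ.suc c) (+ 0) w)
                             (cong (_+ w) (ℤₚ.+-identityʳ (+ ℕ.suc c)))))
  ∼-ECvalue true  true  w (fin (Fin.suc j)) =
    trans (∼-clamp (toℤ (Fin.suc j) - w))
          (cong clamp (trans (sub-sub (+ ℕ.suc c) (toℤ (Fin.suc j)) w)
                             (cong (_+ w) (sym (toℤ-suc-opposite j)))))

module _ (G : WGS) (c : ℕ) where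
  open WGS G

  private
    1+c+w≤0 : ∀ w → w + + c ℤ.< + 0 → + ℕ.suc c + w ℤ.≤ + 0
    1+c+w≤0 w w+c<0 =
      subst (ℤ._≤ + 0) (trans (cong ℤ.suc (ℤₚ.+-comm w (+ c))) (sym (ℤₚ.suc-+ c w)))
            (ℤₚ.i<j⇒suc[i]≤j w+c<0)

    c<1+c+w : ∀ w → + 0 ℤ.≤ w → + c ℤ.< + ℕ.suc c + w
    c<1+c+w (+ n) _ = +<+ (ℕ.s≤s (ℕₚ.m≤m+n c n))

  EC-value : ∀ s s' e → EC G c s s' e ≡ ECvalue (ρe s (proj₁ s')) (ρs s s') (ws s s') e
  EC-value s s' e with ρe s (proj₁ s')
  ... | false = refl
  ... | true with e | ρs s s'
  ...   | ∞     | false = refl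
  ...   | ∞     | true  = refl
  ...   | fin _ | false = refl
  ...   | fin k | true with toℤ k - ws s s' ℤ.≤? + c
  ...     | yes _   = refl
  ...     | no d≰c  = sym (clamp-above (ℤₚ.≰⇒> d≰c))

  ECbar-value : ∀ s s' e → ECbar G c s s' e ≡ ECbarValue (ρe s (proj₁ s')) (ρs s s') (ws s s') e
  ECbar-value s s' e with ρe s (proj₁ s')
  ... | false = refl
  ... | true with e | ρs s s'
  ...   | fin Fin.zero    | false = refl
  ...   | fin Fin.zero    | true  = refl
  ...   | ∞               | false = refl
  ...   | fin (Fin.suc _) | false = refl
  ...   | ∞ | true with ws s s' + + c ℤ.<? + 0
  ...     | yes w+c<0 = sym (clamp-nonpos (1+c+w≤0 (ws s s') w+c<0))
  ...     | no _ with + 0 ℤ.≤? ws s s'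
  ...       | yes 0≤w = sym (clamp-above (c<1+c+w (ws s s') 0≤w))
  ...       | no _    = refl
  ECbar-value s s' e | true | fin (Fin.suc j) | true with toℤ (Fin.suc j) + ws s s' ℤ.≤? + 0
  ... | yes t≤0 = sym (clamp-nonpos t≤0)
  ... | no _ with + c ℤ.<? toℤ (Fin.suc j) + ws s s'
  ...   | yes c<t = sym (clamp-above c<t)
  ...   | no _    = refl

  ∼-EC : ∀ s s' e → ∼ EC G c s s' e ≡ ECbar G c s s' (∼ e)
  ∼-EC s s' e =
    trans (cong ∼_ (EC-value s s' e))
          (trans (∼-ECvalue (ρe s (proj₁ s')) (ρs s s') (ws s s') e)
                 (sym (ECbar-value s s' (∼ e))))

lemmaA3 : (G : WGS) (c : ℕ) (f : EF G c) (s : WGS.State G) →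
          ∼F {G} {c} (ECpreSys G c f) s ≡ ECpreEnvBar G c (∼F {G} {c} f) s
lemmaA3 G c f s =
  trans (∼-maxL-map _ (allVecs nx)) (cong minL (map-cong ∼-inner (allVecs nx)))
  where
  open WGS G

  ∼-inner : ∀ sx → ∼ minL (map (λ sy → EC G c s (sx , sy) (f (sx , sy))) (allVecs ny))
                 ≡ maxL (map (λ sy → ECbar G c s (sx , sy) (∼ f (sx , sy))) (allVecs ny))
  ∼-inner sx =
    trans (∼-minL-map _ (allVecs ny))
          (cong maxL (map-cong (λ sy → ∼-EC G c s (sx , sy) (f (sx , sy))) (allVecs ny)))
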